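{- Let $n$ be a composite positive integer. Then there exists an irreducible set $A$ of $n$ distinct nonnegative integer digits such that the $n$-ary number system $A$ has the uniqueness property, but $A$ contains two numbers that are congruent modulo $n$.
   Context: A set $A=\{a_1,\ldots,a_n\}$ of nonnegative integers with $a_1<\cdots<a_n$ is irreducible if $\gcd(a_2-a_1,\ldots,a_n-a_1,n)=1$. An $A$-expansion of an integer $k\ge0$ is a tuple $(\alpha_0,\ldots,\alpha_J)$ of elements of $A$ with $k=\sum_{j=0}^J\alpha_jn^j$ and $\alpha_J\neq0$ (for $k=0$, the empty tuple). The system $A$ has the uniqueness property if every integer $k\ge0$ has at most one $A$-expansion. -}

module Defs where

open import Data.Nat using (ℕ; zero; suc; _+_; _*_; _∸_)
open import Data.Nat.GCD using (gcd)
open import Data.List using (List; []; _∷_; foldr; map)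
open import Data.List.Relation.Unary.All using (All)
open import Data.List.Membership.Propositional using (_∈_)
open import Data.Unit using (⊤)
open import Data.Empty using (⊥)
open import Relation.Binary.PropositionalEquality using (_≡_; _≢_)

value : ℕ → List ℕ → ℕ
value n []       = 0
value n (a ∷ as) = a + n * value n as

LastNonZero : List ℕ → Set
LastNonZero []           = ⊤
LastNonZero (x ∷ [])     = x ≢ 0
LastNonZero (x ∷ y ∷ xs) = LastNonZero (y ∷ xs)

IsExpansion : ℕ → List ℕ → ℕ → List ℕ → Set
IsExpansion n A k ds = All (_∈ A) ds × (value n ds ≡ k) × LastNonZero ds
  where open import Data.Product using (_×_)

UniquenessProperty : ℕ → List ℕ → Set
UniquenessProperty n A =
  ∀ (k : ℕ) (ds es : List ℕ) → IsExpansion n A k ds → IsExpansion n A k es → ds ≡ es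

-- Irreducible (A = a₁ < … < a_n listed increasingly, n = |A|):
-- gcd(a₂ − a₁, …, a_n − a₁, n) = 1.
Irreducible : ℕ → List ℕ → Set
Irreducible n []       = ⊥
Irreducible n (a ∷ as) = foldr gcd n (map (λ x → x ∸ a) as) ≡ 1

-- Write n = b·a with a, b ≥ 2 and take the n digits i + j·a·n (i < a, j < b). The digits 0 and a·n
-- are congruent modulo n, and 0, 1 are digits, so the set is irreducible. For uniqueness, a digit
-- i + j·a·n contributes i to its own position and j·a to the next one; since i + j′·a < b·a = n,
-- the resulting position sums form an ordinary base-n expansion, from which the pairs (i, j) are
-- recovered one position at a time by uniqueness of Euclidean division.
module Submission where

open import Defs
open import Data.Nat using (ℕ; _<_; _∸_)
open import Data.Nat.Primality using (Composite)
open import Data.Nat.Divisibility using (_∣_)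
open import Data.List using (List; length)
open import Data.List.Relation.Unary.AllPairs using (AllPairs)
open import Data.List.Membership.Propositional using (_∈_)
open import Data.Product using (Σ; ∃; _×_)
open import Relation.Binary.PropositionalEquality using (_≡_)

open import Data.Nat
  using (zero; suc; _+_; _*_; _/_; _%_; _≤_; pred; z<s; s≤s; NonZero; >-nonZero; >-nonZero⁻¹; nonTrivial⇒n>1)
open import Data.Nat.Properties
open import Data.Nat.DivMod
open import Data.Nat.Divisibility using (divides)
open import Data.Nat.Divisibility.Core using (hasNonTrivialDivisor)
open import Data.Nat.GCD using (gcd; gcd-zeroˡ)
open import Data.Nat.Tactic.RingSolver using (solve-∀)
open import Data.List using ([]; _∷_; foldr; map; applyUpTo)
open import Data.List.Properties using (length-applyUpTo)
open import Data.List.Relation.Unary.All as All using (All; []; _∷_)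
open import Data.List.Relation.Unary.AllPairs.Properties using (applyUpTo⁺₁)
open import Data.List.Membership.Propositional.Properties using (∈-applyUpTo⁺; ∈-applyUpTo⁻)
open import Data.Product using (_,_; ∃₂; proj₁; proj₂)
open import Data.Empty using (⊥-elim)
open import Function using (_∘_)
open import Relation.Nullary using (¬_)
open import Relation.Binary.PropositionalEquality
  using (_≢_; refl; sym; trans; cong; cong₂; subst; subst₂; module ≡-Reasoning)

euclid-unique : ∀ {m r r′ q q′} .{{_ : NonZero m}} → r < m → r′ < m →
                r + q * m ≡ r′ + q′ * m → r ≡ r′ × q ≡ q′
euclid-unique {m} {r} {r′} {q} {q′} r<m r′<m eq =
  r≡r′ , *-cancelʳ-≡ q q′ m (+-cancelˡ-≡ r _ _ (trans eq (cong (_+ q′ * m) (sym r≡r′))))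
  where
  open ≡-Reasoning
  r≡r′ : r ≡ r′
  r≡r′ = begin
    r                 ≡⟨ m<n⇒m%n≡m r<m ⟨
    r % m             ≡⟨ [m+kn]%n≡m%n r q m ⟨
    (r + q * m) % m   ≡⟨ cong (_% m) eq ⟩
    (r′ + q′ * m) % m ≡⟨ [m+kn]%n≡m%n r′ q′ m ⟩
    r′ % m            ≡⟨ m<n⇒m%n≡m r′<m ⟩
    r′                ∎

composite⇒factors : ∀ {n} → Composite n → ∃₂ λ a b → 1 < a × 1 < b × n ≡ b * a
composite⇒factors {n} (hasNonTrivialDivisor {d} {{d-nontrivial}} d<n (divides q n≡q*d)) =
  d , q , nonTrivial⇒n>1 d {{d-nontrivial}} , ≰⇒> q≰1 , n≡q*d
  where
  open ≤-Reasoning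
  q≰1 : ¬ q ≤ 1
  q≰1 q≤1 = <⇒≱ d<n (begin
    n      ≡⟨ n≡q*d ⟩
    q * d  ≤⟨ *-monoˡ-≤ d q≤1 ⟩
    1 * d  ≡⟨ *-identityˡ d ⟩
    d      ∎)

LastNonZero-tail : ∀ x xs → LastNonZero (x ∷ xs) → LastNonZero xs
LastNonZero-tail x []       _    = _
LastNonZero-tail x (y ∷ ys) last = last

value-∷-nonzero : ∀ {n} .{{_ : NonZero n}} x xs → LastNonZero (x ∷ xs) → value n (x ∷ xs) ≢ 0
value-∷-nonzero x []             x≢0  v≡0 = x≢0 (m+n≡0⇒m≡0 x v≡0)
value-∷-nonzero {n} x (y ∷ ys) last v≡0 =
  value-∷-nonzero y ys last
    (m*n≡0⇒m≡0 _ n (trans (*-comm (value n (y ∷ ys)) n) (m+n≡0⇒n≡0 x v≡0)))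

applyUpTo-irreducible : ∀ s f m → 1 < m → f 1 ∸ f 0 ≡ 1 → Irreducible s (applyUpTo f m)
applyUpTo-irreducible s f (suc zero)    (s≤s ())
applyUpTo-irreducible s f (suc (suc m)) _ gap =
  trans (cong (λ g → gcd g rest) gap) (gcd-zeroˡ rest)
  where rest = foldr gcd s (map (λ x → x ∸ f 0) (applyUpTo (f ∘ suc ∘ suc) m))

carry-split : ∀ a n c i j v → c * a + (i + j * a * n + n * v) ≡ (i + c * a) + (j * a + v) * n
carry-split = solve-∀

module BlockDigits (a b : ℕ) .{{_ : NonZero a}} .{{_ : NonZero b}} where

  n : ℕ
  n = b * a

  instance
    n-nonZero : NonZero n
    n-nonZero = m*n≢0 b a

  digit : ℕ → ℕ
  digit k = k % a + k / a * a * n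

  digits : List ℕ
  digits = applyUpTo digit n

  IsDigit : ℕ → Set
  IsDigit x = ∃₂ λ i j → i < a × j < b × x ≡ i + j * a * n

  ∈digits⇒IsDigit : ∀ {x} → x ∈ digits → IsDigit x
  ∈digits⇒IsDigit x∈digits with k , k<n , refl ← ∈-applyUpTo⁻ digit x∈digits =
    k % a , k / a , m%n<n k a , m<n*o⇒m/o<n k<n , refl

  k<a⇒digit[k]≡k : ∀ {k} → k < a → digit k ≡ k
  k<a⇒digit[k]≡k {k} k<a = begin
    k % a + k / a * a * n  ≡⟨ cong₂ (λ r q → r + q * a * n) (m<n⇒m%n≡m k<a) (m<n⇒m/n≡0 k<a) ⟩
    k + 0                  ≡⟨ +-identityʳ k ⟩
    k                      ∎
    where open ≡-Reasoning

  digit[a]≡a*n : digit a ≡ a * n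
  digit[a]≡a*n = begin
    a % a + a / a * a * n  ≡⟨ cong₂ (λ r q → r + q * a * n) (n%n≡0 a) (n/n≡1 a) ⟩
    1 * a * n              ≡⟨ cong (_* n) (*-identityˡ a) ⟩
    a * n                  ∎
    where open ≡-Reasoning

  digit≡k+[k/a]*a*pred[n] : ∀ k → digit k ≡ k + k / a * a * pred n
  digit≡k+[k/a]*a*pred[n] k = begin
    k % a + k / a * a * n                          ≡⟨ cong (λ m → k % a + k / a * a * m) (suc-pred n) ⟨
    k % a + k / a * a * suc (pred n)               ≡⟨ cong (k % a +_) (*-suc (k / a * a) (pred n)) ⟩
    k % a + (k / a * a + k / a * a * pred n)       ≡⟨ +-assoc (k % a) _ _ ⟨
    (k % a + k / a * a) + k / a * a * pred n       ≡⟨ cong (_+ k / a * a * pred n) (m≡m%n+[m/n]*n k a) ⟨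
    k + k / a * a * pred n                         ∎
    where open ≡-Reasoning

  digit-strictMono : ∀ {j k} → j < k → digit j < digit k
  digit-strictMono {j} {k} j<k =
    subst₂ _<_ (sym (digit≡k+[k/a]*a*pred[n] j)) (sym (digit≡k+[k/a]*a*pred[n] k))
    (+-mono-<-≤ j<k (*-monoˡ-≤ (pred n) (*-monoˡ-≤ a (/-monoˡ-≤ a (<⇒≤ j<k)))))

  digits-sorted : AllPairs _<_ digits
  digits-sorted = applyUpTo⁺₁ digit n (λ i<j _ → digit-strictMono i<j)

  i+c*a<n : ∀ {i c} → i < a → c < b → i + c * a < n
  i+c*a<n {i} {c} i<a c<b = begin-strict
    i + c * a  <⟨ +-monoˡ-< (c * a) i<a ⟩
    suc c * a  ≤⟨ *-monoˡ-≤ a c<b ⟩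
    b * a      ∎
    where open ≤-Reasoning

  carry≢expansion : ∀ {c c′ e} es → c < b → c′ < b → IsDigit e → LastNonZero (e ∷ es) →
                    c * a + 0 ≢ c′ * a + value n (e ∷ es)
  carry≢expansion {c} {c′} es c<b c′<b (i , j , i<a , j<b , refl) last eq =
    value-∷-nonzero {n} _ es last value≡0
    where
    0<a = >-nonZero⁻¹ a
    low-high : c * a ≡ i + c′ * a × 0 ≡ j * a + value n es
    low-high = euclid-unique {q = 0} (i+c*a<n 0<a c<b) (i+c*a<n i<a c′<b)
      (trans eq (carry-split a n c′ i j (value n es)))
    i≡0 : i ≡ 0
    i≡0 = sym (proj₁ (euclid-unique {q = c} {c′} 0<a i<a (proj₁ low-high)))
    j*a≡0 : j * a ≡ 0
    j*a≡0 = m+n≡0⇒m≡0 (j * a) (sym (proj₂ low-high))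
    tail≡0 : value n es ≡ 0
    tail≡0 = m+n≡0⇒n≡0 (j * a) (sym (proj₂ low-high))
    value≡0 : i + j * a * n + n * value n es ≡ 0
    value≡0 = begin
      i + j * a * n + n * value n es
        ≡⟨ cong₂ _+_ (cong₂ (λ x y → x + y * n) i≡0 j*a≡0) (cong (n *_) tail≡0) ⟩
      n * 0                           ≡⟨ *-zeroʳ n ⟩
      0                               ∎
      where open ≡-Reasoning

  -- c·a is the part j·a carried over from the previous digit.
  expansion-injective : ∀ {c c′} ds es → c < b → c′ < b → All IsDigit ds → All IsDigit es →
                        LastNonZero ds → LastNonZero es →
                        c * a + value n ds ≡ c′ * a + value n es → ds ≡ es
  expansion-injective [] [] _ _ _ _ _ _ _ = refl
  expansion-injective [] (_ ∷ es) c<b c′<b [] (e-digit ∷ _) _ last eq =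
    ⊥-elim (carry≢expansion es c<b c′<b e-digit last eq)
  expansion-injective (_ ∷ ds) [] c<b c′<b (d-digit ∷ _) [] last _ eq =
    ⊥-elim (carry≢expansion ds c′<b c<b d-digit last (sym eq))
  expansion-injective {c} {c′} (_ ∷ ds) (_ ∷ es) c<b c′<b
    ((i , j , i<a , j<b , refl) ∷ ds-digits) ((i′ , j′ , i′<a , j′<b , refl) ∷ es-digits)
    last-d last-e eq = cong₂ _∷_ (cong₂ (λ i j → i + j * a * n) i≡i′ j≡j′) ds≡es
    where
    low-high : i + c * a ≡ i′ + c′ * a × j * a + value n ds ≡ j′ * a + value n es
    low-high = euclid-unique (i+c*a<n i<a c<b) (i+c*a<n i′<a c′<b)
      (trans (sym (carry-split a n c i j (value n ds)))
             (trans eq (carry-split a n c′ i′ j′ (value n es))))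
    ds≡es : ds ≡ es
    ds≡es = expansion-injective ds es j<b j′<b ds-digits es-digits
      (LastNonZero-tail _ ds last-d) (LastNonZero-tail _ es last-e) (proj₂ low-high)
    j≡j′ : j ≡ j′
    j≡j′ = *-cancelʳ-≡ j j′ a (+-cancelʳ-≡ _ _ _
      (trans (proj₂ low-high) (cong (λ xs → j′ * a + value n xs) (sym ds≡es))))
    i≡i′ : i ≡ i′
    i≡i′ = proj₁ (euclid-unique {q = c} {c′} i<a i′<a (proj₁ low-high))

  digits-unique : UniquenessProperty n digits
  digits-unique _ ds es (ds∈digits , ds-value , ds-last) (es∈digits , es-value , es-last) =
    expansion-injective ds es (>-nonZero⁻¹ b) (>-nonZero⁻¹ b)
      (All.map ∈digits⇒IsDigit ds∈digits) (All.map ∈digits⇒IsDigit es∈digits)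
      ds-last es-last (trans ds-value (sym es-value))

  digits-irreducible : 1 < a → Irreducible n digits
  digits-irreducible 1<a = applyUpTo-irreducible n digit n (<-≤-trans 1<a (m≤n*m a b))
    (cong₂ _∸_ (k<a⇒digit[k]≡k 1<a) (k<a⇒digit[k]≡k (>-nonZero⁻¹ a)))

  digits-congruent-pair : 1 < b → ∃ λ x → ∃ λ y → x ∈ digits × y ∈ digits × x < y × n ∣ (y ∸ x)
  digits-congruent-pair 1<b =
    digit 0 , digit a , ∈-applyUpTo⁺ digit (>-nonZero⁻¹ n) , ∈-applyUpTo⁺ digit a<n ,
    digit-strictMono 0<a ,
    subst (n ∣_) (sym (cong₂ _∸_ digit[a]≡a*n (k<a⇒digit[k]≡k 0<a))) (divides a refl)
    where
    0<a = >-nonZero⁻¹ a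
    a<n : a < n
    a<n = subst (a <_) (*-comm a b) (m<m*n a b 1<b)

theorem3 : (n : ℕ) → 0 < n → Composite n →
    Σ (List ℕ) λ A →
    AllPairs _<_ A × length A ≡ n × Irreducible n A × UniquenessProperty n A ×
    (∃ λ x → ∃ λ y → x ∈ A × y ∈ A × x < y × n ∣ (y ∸ x))
theorem3 _ _ composite with composite⇒factors composite
... | a , b , 1<a , 1<b , refl =
  digits , digits-sorted , length-applyUpTo digit n , digits-irreducible 1<a , digits-unique ,
  digits-congruent-pair 1<b
  where open BlockDigits a b {{>-nonZero (<-trans z<s 1<a)}} {{>-nonZero (<-trans z<s 1<b)}}
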